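{- Let $D$ be a directed tree, let $S,T\subseteq V(D)$ be two configurations with $|S|=|T|$ such that every leaf of $D$ lies in $S\,\Delta\,T$, and let $\mu:S\to T$ be a one-to-one mapping such that $s\neq\mu(s)$ and there is a directed path from $s$ to $\mu(s)$ for every $s\in S$. Then there exists a transforming sequence from $S$ to $T$ in $D$.
   Context: A directed tree is a digraph whose underlying undirected graph is a tree. Tokens sit on vertices; a configuration is a set of vertices (one token on each). A move is a pair $(s,t)$; executing it moves the token on $s$ to $t$. A vertex is free if it carries no token; a directed path is free if all its intermediate vertices are free. A move $(s,t)$ in a sequence is valid if, after executing the preceding moves, there is a token on $s$, $t$ is free, and there is a free directed path from $s$ to $t$. A transforming sequence from $S$ to $T$ is a sequence of valid moves whose execution from $S$ yields $T$. $S\,\Delta\,T$ denotes the symmetric difference. -}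

module Defs where

open import Data.Nat using (ℕ; suc; _+_)
open import Data.Fin using (Fin)
open import Data.Fin.Subset using (Subset; _∈_; _∉_; inside; outside)
open import Data.Product using (_×_; _,_; Σ; ∃)
open import Data.Sum using (_⊎_)
open import Data.List using (List; []; _∷_; length; filter)
open import Data.List.Relation.Unary.All using (All)
open import Data.List.Relation.Unary.Unique.Propositional using (Unique)
import Data.List.Membership.Propositional as LM
open import Data.Vec using (_[_]≔_)
open import Relation.Binary.PropositionalEquality using (_≡_)
open import Data.Fin using (_≟_)
open import Relation.Nullary.Decidable using (_⊎-dec_)

-- A digraph on vertex set Fin n, given by its list of arcs (u , v) meaning u → v.
Arcs : ℕ → Set
Arcs n = List (Fin n × Fin n)

module _ {n : ℕ} (E : Arcs n) where

  data DWalk : Fin n → Fin n → Set where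
    here : ∀ {v} → DWalk v v
    step : ∀ {u v w} → (u , v) LM.∈ E → DWalk v w → DWalk u w

  data UWalk : Fin n → Fin n → Set where
    here : ∀ {v} → UWalk v v
    fwd  : ∀ {u v w} → (u , v) LM.∈ E → UWalk v w → UWalk u w
    bwd  : ∀ {u v w} → (v , u) LM.∈ E → UWalk v w → UWalk u w

  -- the underlying undirected graph is a tree: connected with |V| - 1 edges
  -- (standard characterisation of a tree; it forces |V| ≥ 1, no loops/multi-edges)
  DirectedTree : Set
  DirectedTree = (∀ u v → UWalk u v) × (length E + 1 ≡ n)

  degree : Fin n → ℕ
  degree v = length (filter (λ a → (Data.Product.proj₁ a ≟ v) ⊎-dec (Data.Product.proj₂ a ≟ v)) E)

  IsLeaf : Fin n → Set
  IsLeaf v = degree v ≡ 1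

  verts : ∀ {u w} → DWalk u w → List (Fin n)
  verts {u} here = u ∷ []
  verts {u} (step e p) = u ∷ verts p

  inner : ∀ {u w} → DWalk u w → List (Fin n)
  inner here = []
  inner (step e here) = []
  inner (step {v = v} e (step e' p)) = v ∷ inner (step e' p)

  IsDPath : ∀ {u w} → DWalk u w → Set
  IsDPath p = Unique (verts p)

  HasDPath : Fin n → Fin n → Set
  HasDPath s t = Σ (DWalk s t) IsDPath

  Move : Set
  Move = Fin n × Fin n

  execute : Subset n → Move → Subset n
  execute C (s , t) = (C [ s ]≔ outside) [ t ]≔ inside

  ValidMove : Subset n → Move → Set
  ValidMove C (s , t) =
    s ∈ C × t ∉ C × Σ (DWalk s t) (λ p → IsDPath p × All (_∉ C) (inner p))

  Transforms : Subset n → List Move → Subset n → Set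
  Transforms C [] T = C ≡ T
  Transforms C (m ∷ ms) T = ValidMove C m × Transforms (execute C m) ms T

_∈Δ_,_ : ∀ {n} → Fin n → Subset n → Subset n → Set
v ∈Δ S , T = (v ∈ S × v ∉ T) ⊎ (v ∉ S × v ∈ T)

{-# OPTIONS --safe #-}
module Submission where

-- Keep a bijection μ from the current
-- configuration C onto T and, for each token not yet at its target, a walk
-- to the target whose length is below the token's budget. Pick such a token
-- s₀, its walk to t = μ(s₀), and the last occupied vertex s′ on that walk.
-- If s′ ≠ t, the rest of the walk is free, so the token on s′ can move to t.
-- Either way the token on t is declared finished, and s₀ takes over the old
-- target of s′, reached through s′, with the budgets of s₀ and s′ merged
-- minus one. The total budget strictly decreases, and once every token is at
-- its target, |C| = |T| forces C = T.

open import Defs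
open import Data.Nat using (ℕ; suc; _+_; _∸_; _≤_; _<_; s≤s; z≤n)
open import Data.Nat.Induction using (<-wellFounded)
open import Data.Nat.Properties hiding (_≟_)
open import Algebra.Properties.Monoid.Sum +-0-monoid using (sum)
open import Data.Fin using (Fin; _≟_)
open import Data.Fin.Properties using (any?)
open import Data.Fin.Subset using (Subset; _∈_; _∉_; ∣_∣; inside; outside; _⊆_)
open import Data.Fin.Subset.Properties using (_∈?_; ⊆-antisym; p⊂q⇒∣p∣<∣q∣)
open import Data.List using (List; []; _∷_; _++_)
open import Data.List.Relation.Unary.All using (All; []; _∷_)
open import Data.List.Relation.Unary.All.Properties using (¬Any⇒All¬)
open import Data.List.Relation.Unary.Any using (here; there)
open import Data.List.Relation.Unary.AllPairs using ([]; _∷_)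
import Data.List.Membership.Propositional as List
import Data.List.Membership.DecPropositional as DecList
open import Data.Product using (Σ; ∃; _×_; _,_; proj₁; proj₂)
open import Data.Sum using (_⊎_; inj₁; inj₂)
import Data.Sum as Sum
open import Data.Vec using (_∷_; _[_]=_; _[_]≔_; here; there)
open import Data.Vec.Properties using ([]=-injective; []≔-updates; []=⇒lookup; lookup⇒[]=; lookup∘update′)
open import Data.Vec.Functional using (updateAt)
open import Data.Vec.Functional.Properties using (updateAt-updates; updateAt-minimal)
open import Function using (id; const; _∘_)
open import Induction.WellFounded using (Acc; acc)
open import Relation.Binary.PropositionalEquality
open import Relation.Nullary using (¬_; yes; no; contradiction)
open import Relation.Nullary.Decidable using (_×-dec_; ¬?; decidable-stable)
open import Relation.Unary using (Pred; Decidable)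

_[_↦_] : ∀ {A : Set} {n} → (Fin n → A) → Fin n → A → Fin n → A
f [ a ↦ x ] = updateAt f a (const x)

[↦]-≡ : ∀ {A : Set} {n} (f : Fin n → A) a {x} → (f [ a ↦ x ]) a ≡ x
[↦]-≡ f a = updateAt-updates a f

[↦]-≢ : ∀ {A : Set} {n} (f : Fin n → A) {a i x} → i ≢ a → (f [ a ↦ x ]) i ≡ f i
[↦]-≢ f {a} {i} i≢a = updateAt-minimal i a f i≢a

sum-[↦] : ∀ {n} (f : Fin n → ℕ) a x → sum (f [ a ↦ x ]) + f a ≡ sum f + x
sum-[↦] f Fin.zero x = begin
  x + s + f Fin.zero   ≡⟨ +-comm (x + s) (f Fin.zero) ⟩
  f Fin.zero + (x + s) ≡⟨ cong (f Fin.zero +_) (+-comm x s) ⟩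
  f Fin.zero + (s + x) ≡⟨ +-assoc (f Fin.zero) s x ⟨
  f Fin.zero + s + x   ∎
  where
  open ≡-Reasoning
  s = sum (λ i → f (Fin.suc i))
sum-[↦] f (Fin.suc a) x = begin
  f Fin.zero + sum (g [ a ↦ x ]) + g a   ≡⟨ +-assoc (f Fin.zero) _ (g a) ⟩
  f Fin.zero + (sum (g [ a ↦ x ]) + g a) ≡⟨ cong (f Fin.zero +_) (sum-[↦] g a x) ⟩
  f Fin.zero + (sum g + x)               ≡⟨ +-assoc (f Fin.zero) (sum g) x ⟨
  f Fin.zero + sum g + x                 ∎
  where
  open ≡-Reasoning
  g = λ i → f (Fin.suc i)

n≤m+n∸1 : ∀ {m} n → 0 < m → n ≤ m + n ∸ 1
n≤m+n∸1 {suc m} n _ = m≤n+m n m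

m+n∸1<m+n : ∀ {m} n → 0 < m → m + n ∸ 1 < m + n
m+n∸1<m+n {suc m} n _ = n<1+n (m + n)

sum-transfer-< : ∀ {n} (f : Fin n → ℕ) a b → 0 < f a →
                 sum ((f [ a ↦ f a + f b ∸ 1 ]) [ b ↦ 0 ]) < sum f
sum-transfer-< f a b 0<fa = +-cancelʳ-< (f b + f a) (sum h) (sum f) (begin-strict
  sum h + (f b + f a) ≤⟨ +-monoʳ-≤ (sum h) (+-monoˡ-≤ (f a) fb≤gb) ⟩
  sum h + (g b + f a) ≡⟨ +-assoc (sum h) (g b) (f a) ⟨
  sum h + g b + f a   ≡⟨ cong (_+ f a) (trans (sum-[↦] g b 0) (+-identityʳ (sum g))) ⟩
  sum g + f a         ≡⟨ sum-[↦] f a y ⟩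
  sum f + y           <⟨ +-monoʳ-< (sum f) (m+n∸1<m+n (f b) 0<fa) ⟩
  sum f + (f a + f b) ≡⟨ cong (sum f +_) (+-comm (f a) (f b)) ⟩
  sum f + (f b + f a) ∎)
  where
  open ≤-Reasoning
  y = f a + f b ∸ 1
  g = f [ a ↦ y ]
  h = g [ b ↦ 0 ]
  fb≤gb : f b ≤ g b
  fb≤gb with b ≟ a
  ... | yes refl = subst (f b ≤_) (sym ([↦]-≡ f b)) (n≤m+n∸1 (f b) 0<fa)
  ... | no b≢a   = ≤-reflexive (sym ([↦]-≢ f b≢a))

module Walks {n : ℕ} (E : Arcs n) where

  open DecList {A = Fin n} _≟_ using () renaming (_∈?_ to _∈ᴸ?_)

  length : ∀ {u v} → DWalk E u v → ℕ
  length here       = 0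
  length (step _ p) = suc (length p)

  _++ʷ_ : ∀ {u v w} → DWalk E u v → DWalk E v w → DWalk E u w
  here     ++ʷ q = q
  step e p ++ʷ q = step e (p ++ʷ q)

  length-++ʷ : ∀ {u v w} (p : DWalk E u v) (q : DWalk E v w) →
               length (p ++ʷ q) ≡ length p + length q
  length-++ʷ here       q = refl
  length-++ʷ (step e p) q = cong suc (length-++ʷ p q)

  tailVerts : ∀ {u v} → DWalk E u v → List (Fin n)
  tailVerts here       = []
  tailVerts (step _ p) = verts E p

  module _ {ℓ} {P : Pred (Fin n) ℓ} where

    All-source : ∀ {u v} (p : DWalk E u v) → All P (verts E p) → P u
    All-source here       (pu ∷ _) = pu
    All-source (step _ _) (pu ∷ _) = pu

    All-target : ∀ {u v} (p : DWalk E u v) → All P (verts E p) → P v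
    All-target here       (pv ∷ _)  = pv
    All-target (step _ p) (_ ∷ all) = All-target p all

    All-verts : ∀ {u v} (p : DWalk E u v) → P u → All P (tailVerts p) → All P (verts E p)
    All-verts here       pu _   = pu ∷ []
    All-verts (step _ _) pu all = pu ∷ all

    All-tailVerts : ∀ {u v} (p : DWalk E u v) → All P (verts E p) → All P (tailVerts p)
    All-tailVerts here       _         = []
    All-tailVerts (step _ _) (_ ∷ all) = all

    All-inner : ∀ {u v} (p : DWalk E u v) → All P (tailVerts p) → All P (inner E p)
    All-inner here                _          = []
    All-inner (step _ here)       _          = []
    All-inner (step _ (step e p)) (pv ∷ all) = pv ∷ All-inner (step e p) all

    suffixFrom : ∀ {u v w} (p : DWalk E v w) → u List.∈ verts E p →
                 Σ (DWalk E u w) λ q → (IsDPath E p → IsDPath E q) ×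
                                       (All P (verts E p) → All P (verts E q))
    suffixFrom here       (here refl) = here , id , id
    suffixFrom (step e p) (here refl) = step e p , id , id
    suffixFrom (step e p) (there u∈p) with suffixFrom p u∈p
    ... | q , path , all = q , (λ { (_ ∷ uniq) → path uniq }) , (λ { (_ ∷ ps) → all ps })

    walk⇒path : ∀ {u v} (p : DWalk E u v) → All P (tailVerts p) →
                Σ (DWalk E u v) λ q → IsDPath E q × All P (tailVerts q)
    walk⇒path here _ = here , [] ∷ [] , []
    walk⇒path {u} (step e p) ps with walk⇒path p (All-tailVerts p ps)
    ... | q , q-path , qs with u ∈ᴸ? verts E q
    ...   | no u∉q  = step e q , ¬Any⇒All¬ (verts E q) u∉q ∷ q-path , All-verts q (All-source p ps) qs
    ...   | yes u∈q =
      let r , r-path , rs = suffixFrom q u∈q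
      in r , r-path q-path , All-tailVerts r (rs (All-verts q (All-source p ps) qs))

  record LastSplit {ℓ} (P : Pred (Fin n) ℓ) {u w} (p : DWalk E u w) : Set ℓ where
    constructor split
    field
      {pivot}      : Fin n
      P-pivot      : P pivot
      prefix       : DWalk E u pivot
      suffix       : DWalk E pivot w
      length-split : length prefix + length suffix ≡ length p
      suffix-avoid : All (λ x → ¬ P x) (tailVerts suffix)

  module _ {ℓ} {P : Pred (Fin n) ℓ} (P? : Decidable P) where

    avoid⊎lastSplit : ∀ {u w} (p : DWalk E u w) → All (λ x → ¬ P x) (verts E p) ⊎ LastSplit P p
    avoid⊎lastSplit {u} here with P? u
    ... | yes pu = inj₂ (split pu here here refl [])
    ... | no ¬pu = inj₁ (¬pu ∷ [])
    avoid⊎lastSplit {u} (step e p) with avoid⊎lastSplit p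
    ... | inj₂ (split pv q r eq avoid) = inj₂ (split pv (step e q) r (cong suc eq) avoid)
    ... | inj₁ avoid with P? u
    ...   | yes pu = inj₂ (split pu here (step e p) refl avoid)
    ...   | no ¬pu = inj₁ (¬pu ∷ avoid)

    lastSplit : ∀ {u w} → P u → (p : DWalk E u w) → LastSplit P p
    lastSplit pu p with avoid⊎lastSplit p
    ... | inj₁ avoid = contradiction pu (All-source p avoid)
    ... | inj₂ s     = s

∈-[]≔⁻ : ∀ {m} {p : Subset m} {i j x y} → i ≢ j → (p [ j ]≔ y) [ i ]= x → p [ i ]= x
∈-[]≔⁻ {p = p} {i} {y = y} i≢j i∈ =
  lookup⇒[]= i p (trans (sym (lookup∘update′ i≢j p y)) ([]=⇒lookup i∈))

∣[]≔outside∣ : ∀ {m} (p : Subset m) {i} → i ∈ p → suc ∣ p [ i ]≔ outside ∣ ≡ ∣ p ∣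
∣[]≔outside∣ (inside  ∷ p) here      = refl
∣[]≔outside∣ (inside  ∷ p) (there i∈p) = cong suc (∣[]≔outside∣ p i∈p)
∣[]≔outside∣ (outside ∷ p) (there i∈p) = ∣[]≔outside∣ p i∈p

∣[]≔inside∣ : ∀ {m} (p : Subset m) {i} → i ∉ p → ∣ p [ i ]≔ inside ∣ ≡ suc ∣ p ∣
∣[]≔inside∣ (inside  ∷ p) {Fin.zero}  i∉p = contradiction here i∉p
∣[]≔inside∣ (outside ∷ p) {Fin.zero}  i∉p = refl
∣[]≔inside∣ (inside  ∷ p) {Fin.suc i} i∉p = cong suc (∣[]≔inside∣ p (λ i∈p → i∉p (there i∈p)))
∣[]≔inside∣ (outside ∷ p) {Fin.suc i} i∉p = ∣[]≔inside∣ p (λ i∈p → i∉p (there i∈p))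

module _ {n : ℕ} (E : Arcs n) where

  ∈-execute⁻ : ∀ {C s t i} → i ∈ execute E C (s , t) → i ≡ t ⊎ (i ≢ s × i ∈ C)
  ∈-execute⁻ {C} {s} {t} {i} i∈ with i ≟ t
  ... | yes i≡t = inj₁ i≡t
  ... | no i≢t with i ≟ s
  ...   | yes refl = contradiction ([]=-injective (∈-[]≔⁻ i≢t i∈) ([]≔-updates C s)) λ ()
  ...   | no i≢s   = inj₂ (i≢s , ∈-[]≔⁻ i≢s (∈-[]≔⁻ i≢t i∈))

  ∣execute∣ : ∀ {C s t} → s ∈ C → t ∉ C → ∣ execute E C (s , t) ∣ ≡ ∣ C ∣
  ∣execute∣ {C} {s} {t} s∈C t∉C = begin
    ∣ (C [ s ]≔ outside) [ t ]≔ inside ∣ ≡⟨ ∣[]≔inside∣ (C [ s ]≔ outside) t∉C-s ⟩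
    suc ∣ C [ s ]≔ outside ∣             ≡⟨ ∣[]≔outside∣ C s∈C ⟩
    ∣ C ∣                                ∎
    where
    open ≡-Reasoning
    t∉C-s : t ∉ C [ s ]≔ outside
    t∉C-s t∈ = t∉C (∈-[]≔⁻ (λ { refl → t∉C s∈C }) t∈)

  Transforms-++ : ∀ {C C′ T} {ms ns : List (Move E)} →
                  Transforms E C ms C′ → Transforms E C′ ns T → Transforms E C (ms ++ ns) T
  Transforms-++ {ms = []}    refl        tr = tr
  Transforms-++ {ms = _ ∷ _} (valid , tr) tr′ = valid , Transforms-++ tr tr′

InjectiveOn : ∀ {n} → Subset n → (Fin n → Fin n) → Set
InjectiveOn C f = ∀ s s′ → s ∈ C → s′ ∈ C → f s ≡ f s′ → s ≡ s′

∘-injectiveOn : ∀ {n} {C C′ : Subset n} {f σ ρ : Fin n → Fin n} →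
                (∀ {i} → i ∈ C′ → σ i ∈ C) → (∀ {i} → i ∈ C′ → ρ (σ i) ≡ i) →
                InjectiveOn C f → InjectiveOn C′ (f ∘ σ)
∘-injectiveOn {σ = σ} {ρ} into retract inj i j i∈ j∈ fσi≡fσj = begin
  i         ≡⟨ retract i∈ ⟨
  ρ (σ i)   ≡⟨ cong ρ (inj _ _ (into i∈) (into j∈) fσi≡fσj) ⟩
  ρ (σ j)   ≡⟨ retract j∈ ⟩
  j         ∎
  where open ≡-Reasoning

+-mono-<-∸1 : ∀ {a b m k} → a < m → b < k → a + b < m + k ∸ 1
+-mono-<-∸1 {m = suc m} (s≤s a≤m) b<k = +-mono-≤-< a≤m b<k

1+a<m⇒a<m+k∸1 : ∀ {a m} k → suc a < m → a < m + k ∸ 1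
1+a<m⇒a<m+k∸1 {m = suc m} k (s≤s a<m) = ≤-trans a<m (m≤m+n m k)

module Transformation {n : ℕ} (E : Arcs n) (T : Subset n) where

  open Walks E

  WalkWithin : Fin n → Fin n → ℕ → Set
  WalkWithin u v k = Σ (DWalk E u v) λ p → length p < k

  WalkWithin-cong : ∀ {u v v′ k k′} → v ≡ v′ → k ≡ k′ → WalkWithin u v k → WalkWithin u v′ k′
  WalkWithin-cong refl refl w = w

  record Assignment (C : Subset n) : Set where
    field
      μ           : Fin n → Fin n
      budget      : Fin n → ℕ
      μ-into      : ∀ s → s ∈ C → μ s ∈ T
      μ-injective : InjectiveOn C μ
      ∣C∣≡∣T∣     : ∣ C ∣ ≡ ∣ T ∣
      reach       : ∀ s → s ∈ C → μ s ≡ s ⊎ WalkWithin s (μ s) (budget s)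

    potential : ℕ
    potential = sum budget

  open Assignment

  data Role (C : Subset n) (t s₀ s′ i : Fin n) : Set where
    arrived    : i ≡ t → Role C t s₀ s′ i
    redirected : i ≡ s₀ → i ≢ t → i ≢ s′ → Role C t s₀ s′ i
    unchanged  : i ≢ t → i ≢ s₀ → i ≢ s′ → i ∈ C → Role C t s₀ s′ i

  role : ∀ {C t s′ i} s₀ → i ≡ t ⊎ (i ≢ s′ × i ∈ C) → Role C t s₀ s′ i
  role _ (inj₁ i≡t) = arrived i≡t
  role {t = t} {i = i} s₀ (inj₂ (i≢s′ , i∈C)) with i ≟ t | i ≟ s₀
  ... | yes i≡t | _        = arrived i≡t
  ... | no i≢t  | yes i≡s₀ = redirected i≡s₀ i≢t i≢s′
  ... | no i≢t  | no i≢s₀  = unchanged i≢t i≢s₀ i≢s′ i∈C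

  reassign : ∀ {C C′} (A : Assignment C) {s₀ s′} → s₀ ∈ C → s′ ∈ C →
             (q : DWalk E s₀ s′) → length q < budget A s₀ →
             (μ A s′ ≡ s′ → suc (length q) < budget A s₀) →
             (∀ {i} → i ∈ C′ → i ≡ μ A s₀ ⊎ (i ≢ s′ × i ∈ C)) → ∣ C′ ∣ ≡ ∣ C ∣ →
             Σ (Assignment C′) λ A′ → potential A′ < potential A
  reassign {C} {C′} A {s₀} {s′} s₀∈C s′∈C q q<b₀ fixed⇒q<b₀ C′⊆ ∣C′∣≡∣C∣ = A′ , smaller
    where
    μ₀ = μ A
    b = budget A
    t = μ₀ s₀
    σ ρ : Fin n → Fin n
    σ = (id [ s₀ ↦ s′ ]) [ t ↦ s₀ ]
    ρ = (id [ s′ ↦ s₀ ]) [ s₀ ↦ t ]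
    b′ : Fin n → ℕ
    b′ = (b [ s₀ ↦ b s₀ + b s′ ∸ 1 ]) [ s′ ↦ 0 ]

    σ-into : ∀ {i} → i ∈ C′ → σ i ∈ C
    σ-into i∈ with role s₀ (C′⊆ i∈)
    ... | arrived refl = subst (_∈ C) (sym ([↦]-≡ _ t)) s₀∈C
    ... | redirected refl i≢t _ = subst (_∈ C) (sym (trans ([↦]-≢ _ i≢t) ([↦]-≡ id s₀))) s′∈C
    ... | unchanged i≢t i≢s₀ _ i∈C = subst (_∈ C) (sym (trans ([↦]-≢ _ i≢t) ([↦]-≢ id i≢s₀))) i∈C

    ρσ≡id : ∀ {i} → i ∈ C′ → ρ (σ i) ≡ i
    ρσ≡id {i} i∈ with role s₀ (C′⊆ i∈)
    ... | arrived refl = trans (cong ρ ([↦]-≡ _ t)) ([↦]-≡ _ s₀)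
    ... | redirected refl i≢t i≢s′ = begin
      ρ (σ s₀)  ≡⟨ cong ρ (trans ([↦]-≢ _ i≢t) ([↦]-≡ id s₀)) ⟩
      ρ s′      ≡⟨ [↦]-≢ _ (i≢s′ ∘ sym) ⟩
      (id [ s′ ↦ s₀ ]) s′ ≡⟨ [↦]-≡ id s′ ⟩
      s₀        ∎
      where open ≡-Reasoning
    ... | unchanged i≢t i≢s₀ i≢s′ _ = begin
      ρ (σ i)   ≡⟨ cong ρ (trans ([↦]-≢ _ i≢t) ([↦]-≢ id i≢s₀)) ⟩
      ρ i       ≡⟨ trans ([↦]-≢ _ i≢s₀) ([↦]-≢ id i≢s′) ⟩
      i         ∎
      where open ≡-Reasoning

    reach′ : ∀ i → i ∈ C′ → μ₀ (σ i) ≡ i ⊎ WalkWithin i (μ₀ (σ i)) (b′ i)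
    reach′ i i∈ with role s₀ (C′⊆ i∈)
    ... | arrived refl = inj₁ (cong μ₀ ([↦]-≡ _ t))
    ... | redirected refl i≢t i≢s′ =
      inj₂ (WalkWithin-cong (cong μ₀ (sym σs₀≡s′)) (sym b′s₀≡) walk-via-s′)
      where
      σs₀≡s′ : σ s₀ ≡ s′
      σs₀≡s′ = trans ([↦]-≢ _ i≢t) ([↦]-≡ id s₀)
      b′s₀≡ : b′ s₀ ≡ b s₀ + b s′ ∸ 1
      b′s₀≡ = trans ([↦]-≢ _ i≢s′) ([↦]-≡ b s₀)
      walk-via-s′ : WalkWithin s₀ (μ₀ s′) (b s₀ + b s′ ∸ 1)
      walk-via-s′ with reach A s′ s′∈C
      ... | inj₁ fixed =
        WalkWithin-cong (sym fixed) refl (q , 1+a<m⇒a<m+k∸1 (b s′) (fixed⇒q<b₀ fixed))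
      ... | inj₂ (w , w<b′) =
        q ++ʷ w , subst (_< b s₀ + b s′ ∸ 1) (sym (length-++ʷ q w)) (+-mono-<-∸1 q<b₀ w<b′)
    ... | unchanged i≢t i≢s₀ i≢s′ i∈C =
      Sum.map (trans (cong μ₀ σi≡i)) (WalkWithin-cong (cong μ₀ (sym σi≡i)) (sym b′i≡bi)) (reach A i i∈C)
      where
      σi≡i : σ i ≡ i
      σi≡i = trans ([↦]-≢ _ i≢t) ([↦]-≢ id i≢s₀)
      b′i≡bi : b′ i ≡ b i
      b′i≡bi = trans ([↦]-≢ _ i≢s′) ([↦]-≢ b i≢s₀)

    A′ : Assignment C′
    A′ = record
      { μ           = μ₀ ∘ σ
      ; budget      = b′
      ; μ-into      = λ i i∈ → μ-into A (σ i) (σ-into i∈)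
      ; μ-injective = ∘-injectiveOn {ρ = ρ} σ-into ρσ≡id (μ-injective A)
      ; ∣C∣≡∣T∣     = trans ∣C′∣≡∣C∣ (∣C∣≡∣T∣ A)
      ; reach       = reach′
      }

    smaller : potential A′ < potential A
    smaller = sum-transfer-< b s₀ s′ (≤-trans (s≤s z≤n) q<b₀)

  advance : ∀ {C} (A : Assignment C) {s₀} → s₀ ∈ C → μ A s₀ ≢ s₀ →
            ∃ λ C′ → ∃ λ (ms : List (Move E)) → Transforms E C ms C′ ×
            Σ (Assignment C′) λ A′ → potential A′ < potential A
  advance {C} A {s₀} s₀∈C unfinished with reach A s₀ s₀∈C
  ... | inj₁ fixed = contradiction fixed unfinished
  ... | inj₂ (p , p<b₀) with lastSplit (_∈? C) s₀∈C p
  ...   | split s′∈C q here len≡ _ =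
    C , [] , refl , reassign A s₀∈C s′∈C q q<b₀ t-unfixed stay refl
    where
    q<b₀ : length q < budget A s₀
    q<b₀ = subst (_< budget A s₀) (trans (sym len≡) (+-identityʳ (length q))) p<b₀
    t-unfixed : μ A (μ A s₀) ≡ μ A s₀ → suc (length q) < budget A s₀
    t-unfixed fixed = contradiction (sym (μ-injective A _ _ s₀∈C s′∈C (sym fixed))) unfinished
    stay : ∀ {i} → i ∈ C → i ≡ μ A s₀ ⊎ (i ≢ μ A s₀ × i ∈ C)
    stay {i} i∈C with i ≟ μ A s₀
    ... | yes i≡t = inj₁ i≡t
    ... | no i≢t  = inj₂ (i≢t , i∈C)
  ...   | split {s′} s′∈C q r@(step _ r′) len≡ r-avoids =
    execute E C (s′ , t) , (s′ , t) ∷ [] , (valid , refl) ,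
    reassign A s₀∈C s′∈C q (<-trans (n<1+n _) q<b₀) (λ _ → q<b₀) (∈-execute⁻ E) (∣execute∣ E s′∈C t∉C)
    where
    t = μ A s₀
    t∉C = All-target r′ r-avoids
    q<b₀ : suc (length q) < budget A s₀
    q<b₀ = begin-strict
      suc (length q)                ≤⟨ s≤s (m≤m+n (length q) (length r′)) ⟩
      suc (length q + length r′)    ≡⟨ +-suc (length q) (length r′) ⟨
      length q + length r           ≡⟨ len≡ ⟩
      length p                      <⟨ p<b₀ ⟩
      budget A s₀                   ∎
      where open ≤-Reasoning
    valid : ValidMove E C (s′ , t)
    valid = let path , isPath , path-avoids = walk⇒path r r-avoids
            in s′∈C , t∉C , path , isPath , All-inner path path-avoids

  allFixed⇒≡T : ∀ {C} (A : Assignment C) → (∀ i → i ∈ C → μ A i ≡ i) → C ≡ T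
  allFixed⇒≡T {C} A fixed = ⊆-antisym C⊆T T⊆C
    where
    C⊆T : C ⊆ T
    C⊆T {i} i∈C = subst (_∈ T) (fixed i i∈C) (μ-into A i i∈C)
    T⊆C : T ⊆ C
    T⊆C {i} i∈T with i ∈? C
    ... | yes i∈C = i∈C
    ... | no i∉C  = contradiction (∣C∣≡∣T∣ A) (<⇒≢ (p⊂q⇒∣p∣<∣q∣ (C⊆T , i , i∈T , i∉C)))

  transform : ∀ {C} (A : Assignment C) → Acc _<_ (potential A) →
              ∃ λ (ms : List (Move E)) → Transforms E C ms T
  transform {C} A (acc smaller⇒acc) with any? (λ i → (i ∈? C) ×-dec ¬? (μ A i ≟ i))
  ... | yes (s₀ , s₀∈C , unfinished) =
    let _ , ms , C⇝C′ , A′ , smaller = advance A s₀∈C unfinished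
        ns , C′⇝T = transform A′ (smaller⇒acc smaller)
    in ms ++ ns , Transforms-++ E C⇝C′ C′⇝T
  ... | no none = [] , allFixed⇒≡T A λ i i∈C →
    decidable-stable (μ A i ≟ i) (λ unfinished → none (i , i∈C , unfinished))

  transforming-sequence : ∀ {S} → ∣ S ∣ ≡ ∣ T ∣ → (μ : Fin n → Fin n) →
                          (∀ s → s ∈ S → μ s ∈ T) → InjectiveOn S μ →
                          (∀ s → s ∈ S → DWalk E s (μ s)) →
                          ∃ λ (ms : List (Move E)) → Transforms E S ms T
  transforming-sequence {S} ∣S∣≡∣T∣ μ into injective walk =
    transform initial (<-wellFounded (potential initial))
    where
    budget₀ : Fin n → ℕ
    budget₀ s with s ∈? S
    ... | yes s∈S = suc (length (walk s s∈S))
    ... | no _    = 0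
    reach₀ : ∀ s → s ∈ S → μ s ≡ s ⊎ WalkWithin s (μ s) (budget₀ s)
    reach₀ s s∈S with s ∈? S
    ... | yes s∈S′ = inj₂ (walk s s∈S′ , ≤-refl)
    ... | no s∉S   = contradiction s∈S s∉S
    initial : Assignment S
    initial = record
      { μ = μ ; budget = budget₀ ; μ-into = into ; μ-injective = injective
      ; ∣C∣≡∣T∣ = ∣S∣≡∣T∣ ; reach = reach₀ }

lemma7 : ∀ {n : ℕ} (E : Arcs n) → DirectedTree E →
    (S T : Subset n) → ∣ S ∣ ≡ ∣ T ∣ →
    (∀ v → IsLeaf E v → v ∈Δ S , T) →
    (μ : Fin n → Fin n) →
    (∀ s → s ∈ S → μ s ∈ T) →
    (∀ s s′ → s ∈ S → s′ ∈ S → μ s ≡ μ s′ → s ≡ s′) →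
    (∀ s → s ∈ S → s ≢ μ s × HasDPath E s (μ s)) →
    ∃ λ (ms : List (Move E)) → Transforms E S ms T
lemma7 E _ S T ∣S∣≡∣T∣ _ μ into injective paths =
  Transformation.transforming-sequence E T ∣S∣≡∣T∣ μ into injective
    (λ s s∈S → proj₁ (proj₂ (paths s s∈S)))
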